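{- Let $\mathcal{J}$ be a finite set of jobs, each $j\in\mathcal{J}$ with a positive integer processing time $p_j$ and a nondecreasing cost function $f_j:\{1,2,\dots\}\to\mathbb{Z}_{\ge 0}$. Let $T=\sum_{j\in\mathcal{J}}p_j$, $\mathcal{T}=\{1,\dots,T\}$, and for $t\in\mathcal{T}$ and $A\subseteq\mathcal{J}$ let $D(t)=T-t+1$, $D(t,A)=\max\{D(t)-\sum_{j\in A}p_j,\,0\}$ and $p_j(t,A)=\min\{p_j,D(t,A)\}$. Consider the linear program (P): $$\min \sum_{j\in\mathcal{J}}\sum_{t\in\mathcal{T}} f_j(t)x_{jt}\quad\text{s.t.}\quad \sum_{j\notin A}\ \sum_{s\in\mathcal{T}:\,s\ge t} p_j(t,A)\,x_{js}\ \ge\ D(t,A)\ \ \forall t\in\mathcal{T},\ A\subseteq\mathcal{J};\qquad x_{jt}\ge 0\ \ \forall j\in\mathcal{J},t\in\mathcal{T}.$$ If $x$ is a feasible solution of (P), then there is a feasible solution $\bar x$ of (P) whose objective value is no greater than that of $x$ and which additionally satisfies $\sum_{t\in\mathcal{T}}\bar x_{jt}=1$ for every $j\in\mathcal{J}$.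
   Context: This is the linear programming relaxation, strengthened with knapsack-cover inequalities, of a time-indexed formulation of the single-machine scheduling problem $1||\sum f_j$, where $x_{jt}$ indicates that job $j$ completes at time $t$.
   Formalization: The feasible solution $x$ of (P) has rational entries, and the solution $\bar x$ is likewise taken over ℚ. -}

module Defs where

open import Data.Nat as ℕ using (ℕ; zero; suc; _∸_; _⊓_)
open import Data.Fin using (Fin; zero; suc; toℕ)
open import Data.Fin.Subset using (Subset; _∈_)
open import Data.Fin.Subset.Properties using (_∈?_)
open import Data.Integer using (+_)
open import Data.Rational using (ℚ; 0ℚ; _+_; _*_; _≤_; _/_)
open import Data.Bool using (if_then_else_)
open import Relation.Nullary using (does)
open import Data.Product using (_×_)
open import Function using (_∘_)

sumℕ : ∀ {m} → (Fin m → ℕ) → ℕ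
sumℕ {zero} g = 0
sumℕ {suc m} g = g zero ℕ.+ sumℕ (g ∘ suc)

sumℚ : ∀ {m} → (Fin m → ℚ) → ℚ
sumℚ {zero} g = 0ℚ
sumℚ {suc m} g = g zero + sumℚ (g ∘ suc)

ℕ→ℚ : ℕ → ℚ
ℕ→ℚ k = + k / 1

-- Jobs are Fin n, processing times p : Fin n → ℕ.
-- T = Σ_j p_j.  Time t ∈ {1..T} is represented by k : Fin T with t = toℕ k + 1.
T : ∀ {n} → (Fin n → ℕ) → ℕ
T p = sumℕ p

-- D(t) = T - t + 1 = T ∸ toℕ k
Dt : ∀ {n} (p : Fin n → ℕ) → Fin (T p) → ℕ
Dt p k = T p ∸ toℕ k

pSum : ∀ {n} → (Fin n → ℕ) → Subset n → ℕ
pSum p A = sumℕ (λ j → if does (j ∈? A) then p j else 0)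

DtA : ∀ {n} (p : Fin n → ℕ) → Fin (T p) → Subset n → ℕ
DtA p k A = Dt p k ∸ pSum p A

pjtA : ∀ {n} (p : Fin n → ℕ) → Fin n → Fin (T p) → Subset n → ℕ
pjtA p j k A = p j ⊓ DtA p k A

kcLHS : ∀ {n} (p : Fin n → ℕ) → (Fin n → Fin (T p) → ℚ) → Fin (T p) → Subset n → ℚ
kcLHS p x k A =
  sumℚ (λ j → if does (j ∈? A) then 0ℚ
              else sumℚ (λ s → if does (toℕ k ℕ.≤? toℕ s)
                                then ℕ→ℚ (pjtA p j k A) * x j s
                                else 0ℚ))

Feasible : ∀ {n} (p : Fin n → ℕ) → (Fin n → Fin (T p) → ℚ) → Set
Feasible p x =
  (∀ (k : Fin (T p)) (A : Subset _) → ℕ→ℚ (DtA p k A) ≤ kcLHS p x k A)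
  × (∀ j k → 0ℚ ≤ x j k)

objective : ∀ {n} (p : Fin n → ℕ) → (Fin n → ℕ → ℕ) → (Fin n → Fin (T p) → ℚ) → ℚ
objective p f x = sumℚ (λ j → sumℚ (λ k → ℕ→ℚ (f j (suc (toℕ k))) * x j k))

module Submission where

-- Replace each x_j by the vector x̄_j whose tail sums Σ_{s ≥ t} x̄_js are min(Σ_{s ≥ t} x_js, 1), i.e.
-- remove mass from the earliest periods until at most 1 remains. Then 0 ≤ x̄ ≤ x, so the objective does
-- not increase, and Σ_t x̄_jt = min(Σ_t x_jt, 1) = 1 because the constraint for t = 1, A = J ∖ {j}
-- reads p_j Σ_t x_jt ≥ p_j. For a constraint (t, A), call a job outside A saturated if its tail from t
-- is at least 1, and let P be their total processing time. The constraint of x for A together with the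
-- saturated jobs covers D(t,A) ∸ P with unchanged tails and coefficients min(p_j, D(t,A) ∸ P), while
-- each saturated job contributes min(p_j, D(t,A)) for x̄; these add up to at least min(P, D(t,A)),
-- and min(P, D) + (D ∸ P) = D.

open import Defs
open import Data.Nat using (ℕ; _≤_)
open import Data.Fin using (Fin)
open import Data.Rational using (ℚ; 1ℚ) renaming (_≤_ to _≤ℚ_)
open import Data.Product using (Σ; _×_)
open import Relation.Binary.PropositionalEquality using (_≡_)

open import Algebra.Bundles using (CommutativeMonoid)
import Data.Integer as ℤ
import Data.Integer.Properties as ℤ
open import Data.Bool using (Bool; true; false; if_then_else_; not; _∧_; _∨_)
open import Data.Bool.Properties using (if-float; if-not)
open import Data.Fin as Fin using (zero; suc; toℕ)
import Data.Fin.Properties as Fin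
open import Data.Fin.Subset using (Subset)
open import Data.Fin.Subset.Properties using (_∈?_)
open import Data.Nat as ℕ using (zero; suc)
open import Data.Nat.Coprimality using (1-coprimeTo) renaming (sym to coprime-sym)
import Data.Nat.Properties as ℕ
open import Data.Product using (_,_)
open import Data.Rational as ℚ using (mkℚ; *≤*; 0ℚ; _+_; _-_; _*_; _⊓_)
import Data.Rational.Properties as ℚ
open import Data.Vec using (tabulate)
open import Function using (_∘_)
open import Relation.Binary.PropositionalEquality as P using (refl; cong; cong₂; subst; subst₂)
open import Relation.Nullary using (Dec; does; yes; no)
import Relation.Nullary.Decidable as Dec
open import Relation.Nullary.Decidable using (does-≡)

open import Algebra.Properties.Group ℚ.+-0-group using (//-rightDividesˡ; //-rightDividesʳ)
open import Algebra.Properties.CommutativeSemigroup ℕ.+-commutativeSemigroup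
  using () renaming (interchange to ℕ-interchange)
open import Algebra.Properties.CommutativeSemigroup
  (CommutativeMonoid.commutativeSemigroup ℚ.+-0-commutativeMonoid)
  using () renaming (interchange to ℚ-interchange)

ℕ→ℚ-mkℚ : ∀ k → ℕ→ℚ k ≡ mkℚ (ℤ.+ k) 0 (coprime-sym (1-coprimeTo k))
ℕ→ℚ-mkℚ k = ℚ.normalize-coprime (coprime-sym (1-coprimeTo k))

ℕ→ℚ-+ : ∀ a b → ℕ→ℚ (a ℕ.+ b) ≡ ℕ→ℚ a + ℕ→ℚ b
ℕ→ℚ-+ a b = begin
  (ℤ.+ a ℤ.+ ℤ.+ b) ℚ./ 1
    ≡⟨ cong (ℚ._/ 1) (cong₂ ℤ._+_ (ℤ.*-identityʳ (ℤ.+ a)) (ℤ.*-identityʳ (ℤ.+ b))) ⟨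
  (ℤ.+ a ℤ.* ℤ.+ 1 ℤ.+ ℤ.+ b ℤ.* ℤ.+ 1) ℚ./ 1
    ≡⟨ cong₂ _+_ (ℕ→ℚ-mkℚ a) (ℕ→ℚ-mkℚ b) ⟨
  ℕ→ℚ a + ℕ→ℚ b
    ∎
  where open P.≡-Reasoning

ℕ→ℚ-mono-≤ : ∀ {a b} → a ≤ b → ℕ→ℚ a ≤ℚ ℕ→ℚ b
ℕ→ℚ-mono-≤ {a} {b} a≤b = subst₂ _≤ℚ_ (P.sym (ℕ→ℚ-mkℚ a)) (P.sym (ℕ→ℚ-mkℚ b))
  (*≤* (ℤ.*-monoʳ-≤-nonNeg (ℤ.+ 1) (ℤ.+≤+ a≤b)))

p≤q⇒0≤q-p : ∀ {p q} → p ≤ℚ q → 0ℚ ≤ℚ q - p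
p≤q⇒0≤q-p {p} {q} p≤q = subst (_≤ℚ q - p) (ℚ.+-inverseʳ p) (ℚ.+-monoˡ-≤ (ℚ.- p) p≤q)

p≤r+q⇒p-q≤r : ∀ {p q r} → p ≤ℚ r + q → p - q ≤ℚ r
p≤r+q⇒p-q≤r {p} {q} {r} p≤r+q = subst (p - q ≤ℚ_) (//-rightDividesʳ q r) (ℚ.+-monoˡ-≤ (ℚ.- q) p≤r+q)

[p+q]⊓r≤p+q⊓r : ∀ {p} q r → 0ℚ ≤ℚ p → (p + q) ⊓ r ≤ℚ p + (q ⊓ r)
[p+q]⊓r≤p+q⊓r {p} q r 0≤p = subst ((p + q) ⊓ r ≤ℚ_) (P.sym (ℚ.mono-≤-distrib-⊓ (ℚ.+-monoʳ-≤ p) q r))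
  (ℚ.⊓-monoʳ-≤ (p + q) (subst (_≤ℚ p + r) (ℚ.+-identityˡ r) (ℚ.+-monoˡ-≤ r 0≤p)))

sumℕ-cong : ∀ {m} {g h : Fin m → ℕ} → (∀ i → g i ≡ h i) → sumℕ g ≡ sumℕ h
sumℕ-cong {zero}  g≗h = refl
sumℕ-cong {suc m} g≗h = cong₂ ℕ._+_ (g≗h zero) (sumℕ-cong (g≗h ∘ suc))

sumℕ-+ : ∀ {m} (g h : Fin m → ℕ) → sumℕ (λ i → g i ℕ.+ h i) ≡ sumℕ g ℕ.+ sumℕ h
sumℕ-+ {zero}  g h = refl
sumℕ-+ {suc m} g h = P.trans (cong (g zero ℕ.+ h zero ℕ.+_) (sumℕ-+ (g ∘ suc) (h ∘ suc)))
  (ℕ-interchange (g zero) (h zero) (sumℕ (g ∘ suc)) (sumℕ (h ∘ suc)))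

sumℕ-split : ∀ {m} (b : Fin m → Bool) (g : Fin m → ℕ) →
  sumℕ g ≡ sumℕ (λ i → if b i then g i else 0) ℕ.+ sumℕ (λ i → if not (b i) then g i else 0)
sumℕ-split b g = P.trans (sumℕ-cong (λ i → split (b i)))
  (sumℕ-+ (λ i → if b i then g i else 0) (λ i → if not (b i) then g i else 0))
  where
  split : ∀ c {v} → v ≡ (if c then v else 0) ℕ.+ (if not c then v else 0)
  split true  = P.sym (ℕ.+-identityʳ _)
  split false = refl

sumℕ-zero : ∀ m → sumℕ {m} (λ _ → 0) ≡ 0
sumℕ-zero zero    = refl
sumℕ-zero (suc m) = sumℕ-zero m

sumℕ-if-≡ : ∀ {m} (g : Fin m → ℕ) j → sumℕ (λ i → if does (i Fin.≟ j) then g i else 0) ≡ g j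
sumℕ-if-≡ {suc m} g zero    = P.trans (cong (g zero ℕ.+_) (sumℕ-zero m)) (ℕ.+-identityʳ (g zero))
sumℕ-if-≡ {suc m} g (suc j) = sumℕ-if-≡ (g ∘ suc) j

[m+n]⊓o≤m⊓o+n⊓o : ∀ m n o → (m ℕ.+ n) ℕ.⊓ o ≤ m ℕ.⊓ o ℕ.+ n ℕ.⊓ o
[m+n]⊓o≤m⊓o+n⊓o m n o = subst ((m ℕ.+ n) ℕ.⊓ o ≤_) (P.sym (ℕ.+-distribʳ-⊓ (n ℕ.⊓ o) m o))
  (ℕ.⊓-glb (subst ((m ℕ.+ n) ℕ.⊓ o ≤_) (P.sym (ℕ.+-distribˡ-⊓ m n o))
                  (ℕ.⊓-monoʳ-≤ (m ℕ.+ n) (ℕ.m≤n+m o m)))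
           (ℕ.≤-trans (ℕ.m⊓n≤n (m ℕ.+ n) o) (ℕ.m≤m+n o (n ℕ.⊓ o))))

sumℕ-⊓-subadditive : ∀ {m} (g : Fin m → ℕ) D → sumℕ g ℕ.⊓ D ≤ sumℕ (λ i → g i ℕ.⊓ D)
sumℕ-⊓-subadditive {zero}  g D = ℕ.z≤n
sumℕ-⊓-subadditive {suc m} g D = ℕ.≤-trans ([m+n]⊓o≤m⊓o+n⊓o (g zero) (sumℕ (g ∘ suc)) D)
  (ℕ.+-monoʳ-≤ (g zero ℕ.⊓ D) (sumℕ-⊓-subadditive (g ∘ suc) D))

sumℚ-cong : ∀ {m} {g h : Fin m → ℚ} → (∀ i → g i ≡ h i) → sumℚ g ≡ sumℚ h
sumℚ-cong {zero}  g≗h = refl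
sumℚ-cong {suc m} g≗h = cong₂ _+_ (g≗h zero) (sumℚ-cong (g≗h ∘ suc))

sumℚ-mono-≤ : ∀ {m} {g h : Fin m → ℚ} → (∀ i → g i ≤ℚ h i) → sumℚ g ≤ℚ sumℚ h
sumℚ-mono-≤ {zero}  g≤h = ℚ.≤-refl
sumℚ-mono-≤ {suc m} g≤h = ℚ.+-mono-≤ (g≤h zero) (sumℚ-mono-≤ (g≤h ∘ suc))

sumℚ-zero : ∀ m → sumℚ {m} (λ _ → 0ℚ) ≡ 0ℚ
sumℚ-zero zero    = refl
sumℚ-zero (suc m) = P.trans (ℚ.+-identityˡ _) (sumℚ-zero m)

sumℚ-nonNeg : ∀ {m} {g : Fin m → ℚ} → (∀ i → 0ℚ ≤ℚ g i) → 0ℚ ≤ℚ sumℚ g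
sumℚ-nonNeg {m} {g} 0≤g = subst (_≤ℚ sumℚ g) (sumℚ-zero m) (sumℚ-mono-≤ 0≤g)

sumℚ-+ : ∀ {m} (g h : Fin m → ℚ) → sumℚ (λ i → g i + h i) ≡ sumℚ g + sumℚ h
sumℚ-+ {zero}  g h = refl
sumℚ-+ {suc m} g h = P.trans (cong (g zero + h zero +_) (sumℚ-+ (g ∘ suc) (h ∘ suc)))
  (ℚ-interchange (g zero) (h zero) (sumℚ (g ∘ suc)) (sumℚ (h ∘ suc)))

*-sumℚ : ∀ {m} c (g : Fin m → ℚ) → c * sumℚ g ≡ sumℚ (λ i → c * g i)
*-sumℚ {zero}  c g = ℚ.*-zeroʳ c
*-sumℚ {suc m} c g = P.trans (ℚ.*-distribˡ-+ c (g zero) (sumℚ (g ∘ suc)))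
  (cong (c * g zero +_) (*-sumℚ c (g ∘ suc)))

sumℚ-ℕ→ℚ : ∀ {m} (g : Fin m → ℕ) → sumℚ (ℕ→ℚ ∘ g) ≡ ℕ→ℚ (sumℕ g)
sumℚ-ℕ→ℚ {zero}  g = refl
sumℚ-ℕ→ℚ {suc m} g = P.trans (cong (ℕ→ℚ (g zero) +_) (sumℚ-ℕ→ℚ (g ∘ suc)))
  (P.sym (ℕ→ℚ-+ (g zero) (sumℕ (g ∘ suc))))

sumℚ-if-≡ : ∀ {m} (g : Fin m → ℚ) j → sumℚ (λ i → if does (i Fin.≟ j) then g i else 0ℚ) ≡ g j
sumℚ-if-≡ {suc m} g zero    = P.trans (cong (g zero +_) (sumℚ-zero m)) (ℚ.+-identityʳ (g zero))
sumℚ-if-≡ {suc m} g (suc j) = P.trans (ℚ.+-identityˡ _) (sumℚ-if-≡ (g ∘ suc) j)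

tailSum : ∀ {m} → ℕ → (Fin m → ℚ) → ℚ
tailSum K g = sumℚ (λ s → if does (K ℕ.≤? toℕ s) then g s else 0ℚ)

tailSum-suc : ∀ {m} K (g : Fin (suc m) → ℚ) → tailSum (suc K) g ≡ tailSum K (g ∘ suc)
tailSum-suc K g = P.trans (ℚ.+-identityˡ _) (sumℚ-cong λ s →
  cong (if_then g (suc s) else 0ℚ)
       (does-≡ (suc K ℕ.≤? suc (toℕ s)) (Dec.map′ ℕ.s≤s ℕ.s≤s⁻¹ (K ℕ.≤? toℕ s))))

tailSum-*ˡ : ∀ {m} K c (g : Fin m → ℚ) → tailSum K (λ s → c * g s) ≡ c * tailSum K g
tailSum-*ˡ {m} K c g = begin
  tailSum K (λ s → c * g s)                   ≡⟨ sumℚ-cong {m} (λ s → *-if (K≤ s)) ⟨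
  sumℚ (λ s → c * (if K≤ s then g s else 0ℚ)) ≡⟨ *-sumℚ c (λ s → if K≤ s then g s else 0ℚ) ⟨
  c * tailSum K g                             ∎
  where
  open P.≡-Reasoning
  K≤ : Fin m → Bool
  K≤ s = does (K ℕ.≤? toℕ s)
  *-if : ∀ b {v} → c * (if b then v else 0ℚ) ≡ (if b then c * v else 0ℚ)
  *-if b {v} = P.trans (if-float (c *_) b) (cong (if b then c * v else_) (ℚ.*-zeroʳ c))

tailSum-nonNeg : ∀ {m} K (g : Fin m → ℚ) → (∀ i → 0ℚ ≤ℚ g i) → 0ℚ ≤ℚ tailSum K g
tailSum-nonNeg {m} K g 0≤g = sumℚ-nonNeg {m} λ s → nonNeg-if (does (K ℕ.≤? toℕ s)) (0≤g s)
  where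
  nonNeg-if : ∀ b {v} → 0ℚ ≤ℚ v → 0ℚ ≤ℚ (if b then v else 0ℚ)
  nonNeg-if true  0≤v = 0≤v
  nonNeg-if false _   = ℚ.≤-refl

capTails : ∀ {m} → (Fin m → ℚ) → ℚ → Fin m → ℚ
capTails {suc m} g c zero    = (sumℚ g ⊓ c) - (sumℚ (g ∘ suc) ⊓ c)
capTails {suc m} g c (suc s) = capTails (g ∘ suc) c s

sumℚ-capTails : ∀ {m} (g : Fin m → ℚ) {c} → 0ℚ ≤ℚ c → sumℚ (capTails g c) ≡ sumℚ g ⊓ c
sumℚ-capTails {zero}  g 0≤c = P.sym (ℚ.p≤q⇒p⊓q≡p 0≤c)
sumℚ-capTails {suc m} g {c} 0≤c = P.trans (cong (capTails g c zero +_) (sumℚ-capTails (g ∘ suc) 0≤c))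
  (//-rightDividesˡ (sumℚ (g ∘ suc) ⊓ c) (sumℚ g ⊓ c))

tailSum-capTails : ∀ {m} K (g : Fin m → ℚ) {c} → 0ℚ ≤ℚ c → tailSum K (capTails g c) ≡ tailSum K g ⊓ c
tailSum-capTails {zero}  K       g 0≤c = P.sym (ℚ.p≤q⇒p⊓q≡p 0≤c)
tailSum-capTails {suc m} zero    g 0≤c = sumℚ-capTails g 0≤c
tailSum-capTails {suc m} (suc K) g {c} 0≤c = begin
  tailSum (suc K) (capTails g c)   ≡⟨ tailSum-suc K (capTails g c) ⟩
  tailSum K (capTails (g ∘ suc) c) ≡⟨ tailSum-capTails K (g ∘ suc) 0≤c ⟩
  tailSum K (g ∘ suc) ⊓ c          ≡⟨ cong (_⊓ c) (tailSum-suc K g) ⟨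
  tailSum (suc K) g ⊓ c            ∎
  where open P.≡-Reasoning

capTails-nonNeg : ∀ {m} (g : Fin m → ℚ) c → (∀ i → 0ℚ ≤ℚ g i) → ∀ s → 0ℚ ≤ℚ capTails g c s
capTails-nonNeg {suc m} g c 0≤g zero    = p≤q⇒0≤q-p (ℚ.⊓-monoˡ-≤ c
  (subst (_≤ℚ sumℚ g) (ℚ.+-identityˡ (sumℚ (g ∘ suc))) (ℚ.+-monoˡ-≤ (sumℚ (g ∘ suc)) (0≤g zero))))
capTails-nonNeg {suc m} g c 0≤g (suc s) = capTails-nonNeg (g ∘ suc) c (0≤g ∘ suc) s

capTails-≤ : ∀ {m} (g : Fin m → ℚ) c → (∀ i → 0ℚ ≤ℚ g i) → ∀ s → capTails g c s ≤ℚ g s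
capTails-≤ {suc m} g c 0≤g zero    = p≤r+q⇒p-q≤r ([p+q]⊓r≤p+q⊓r (sumℚ (g ∘ suc)) c (0≤g zero))
capTails-≤ {suc m} g c 0≤g (suc s) = capTails-≤ (g ∘ suc) c (0≤g ∘ suc) s

∈?-tabulate : ∀ {n} (b : Fin n → Bool) j → does (j ∈? tabulate b) ≡ b j
∈?-tabulate {suc n} b zero with b zero
... | true  = refl
... | false = refl
∈?-tabulate {suc n} b (suc j) = ∈?-tabulate (b ∘ suc) j

coverTerm : ∀ {n} (p : Fin n → ℕ) → (Fin n → Fin (T p) → ℚ) → Fin (T p) → Subset n → Fin n → ℚ
coverTerm p y k A j = if does (j ∈? A) then 0ℚ else ℕ→ℚ (pjtA p j k A) * tailSum (toℕ k) (y j)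

kcLHS-coverTerm : ∀ {n} (p : Fin n → ℕ) y k (A : Subset n) → kcLHS p y k A ≡ sumℚ (coverTerm p y k A)
kcLHS-coverTerm p y k A = sumℚ-cong λ j →
  cong (if does (j ∈? A) then 0ℚ else_) (tailSum-*ˡ (toℕ k) (ℕ→ℚ (pjtA p j k A)) (y j))

objective-mono-≤ : ∀ {n} (p : Fin n → ℕ) f {x y : Fin n → Fin (T p) → ℚ} →
  (∀ j s → x j s ≤ℚ y j s) → objective p f x ≤ℚ objective p f y
objective-mono-≤ p f x≤y = sumℚ-mono-≤ λ j → sumℚ-mono-≤ λ s →
  ℚ.*-monoˡ-≤-nonNeg (ℕ→ℚ (f j (suc (toℕ s)))) {{ℚ.normalize-nonNeg (f j (suc (toℕ s))) 1}} (x≤y j s)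

module KnapsackCover {n} (p : Fin n → ℕ) (x : Fin n → Fin (T p) → ℚ) (x≥0 : ∀ j s → 0ℚ ≤ℚ x j s)
                     (k : Fin (T p)) (A : Subset n) where

  τ : Fin n → ℚ
  τ j = tailSum (toℕ k) (x j)

  saturated : Fin n → Bool
  saturated j = not (does (j ∈? A)) ∧ does (1ℚ ℚ.≤? τ j)

  A⁺ : Subset n
  A⁺ = tabulate (λ j → does (j ∈? A) ∨ saturated j)

  pSat : ℕ
  pSat = sumℕ (λ j → if saturated j then p j else 0)

  D : ℕ
  D = DtA p k A

  pSum-A⁺ : pSum p A⁺ ≡ pSum p A ℕ.+ pSat
  pSum-A⁺ = P.trans
    (sumℕ-cong λ j → P.trans (cong (if_then p j else 0) (∈?-tabulate _ j)) (split (does (j ∈? A))))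
    (sumℕ-+ (λ j → if does (j ∈? A) then p j else 0) (λ j → if saturated j then p j else 0))
    where
    split : ∀ a {t v} →
      (if a ∨ (not a ∧ t) then v else 0) ≡ (if a then v else 0) ℕ.+ (if not a ∧ t then v else 0)
    split true  = P.sym (ℕ.+-identityʳ _)
    split false = refl

  DtA-A⁺ : DtA p k A⁺ ≡ D ℕ.∸ pSat
  DtA-A⁺ = P.trans (cong (Dt p k ℕ.∸_) pSum-A⁺) (P.sym (ℕ.∸-+-assoc (Dt p k) (pSum p A) pSat))

  -- A saturated job has capped tail 1 and so earns its bonus
  -- min(p_j, D) in full; any other job keeps its tail t < 1, and its coefficient can only grow from A⁺ to A.
  termwise-cases : ∀ (inA : Bool) {t t̄ : ℚ} (t≥1? : Dec (1ℚ ≤ℚ t)) {m m⁺ : ℕ} →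
    0ℚ ≤ℚ t → t̄ ≡ t ⊓ 1ℚ → m⁺ ≤ m →
    ℕ→ℚ (if not inA ∧ does t≥1? then m else 0) + (if inA ∨ (not inA ∧ does t≥1?) then 0ℚ else ℕ→ℚ m⁺ * t)
      ≤ℚ (if inA then 0ℚ else ℕ→ℚ m * t̄)
  termwise-cases true _ _ _ _ = ℚ.≤-refl
  termwise-cases false (yes t≥1) {m} _ refl _ =
    ℚ.≤-reflexive (P.trans (ℚ.+-identityʳ (ℕ→ℚ m))
      (P.sym (P.trans (cong (ℕ→ℚ m *_) (ℚ.p≥q⇒p⊓q≡q t≥1)) (ℚ.*-identityʳ (ℕ→ℚ m)))))
  termwise-cases false {t} (no t≱1) {m} t≥0 refl m⁺≤m =
    subst₂ _≤ℚ_ (P.sym (ℚ.+-identityˡ _)) (cong (ℕ→ℚ m *_) (P.sym (ℚ.p≤q⇒p⊓q≡p (ℚ.<⇒≤ (ℚ.≰⇒> t≱1)))))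
      (ℚ.*-monoʳ-≤-nonNeg t {{ℚ.nonNegative t≥0}} (ℕ→ℚ-mono-≤ m⁺≤m))

  x̄ : Fin n → Fin (T p) → ℚ
  x̄ j = capTails (x j) 1ℚ

  bonus : Fin n → ℕ
  bonus j = if saturated j then p j ℕ.⊓ D else 0

  termwise : ∀ j → ℕ→ℚ (bonus j) + coverTerm p x k A⁺ j ≤ℚ coverTerm p x̄ k A j
  termwise j = subst
    (λ b → ℕ→ℚ (bonus j) + (if b then 0ℚ else ℕ→ℚ (pjtA p j k A⁺) * τ j) ≤ℚ coverTerm p x̄ k A j)
    (P.sym (∈?-tabulate (λ i → does (i ∈? A) ∨ saturated i) j))
    (termwise-cases (does (j ∈? A)) (1ℚ ℚ.≤? τ j) (tailSum-nonNeg (toℕ k) (x j) (x≥0 j))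
      (tailSum-capTails (toℕ k) (x j) (ℚ.nonNegative⁻¹ 1ℚ))
      (ℕ.⊓-monoʳ-≤ (p j) (subst (_≤ D) (P.sym DtA-A⁺) (ℕ.m∸n≤m D pSat))))

  sumℕ-bonus : pSat ℕ.⊓ D ≤ sumℕ bonus
  sumℕ-bonus = subst (pSat ℕ.⊓ D ≤_) (sumℕ-cong λ j → if-float (ℕ._⊓ D) (saturated j))
    (sumℕ-⊓-subadditive (λ j → if saturated j then p j else 0) D)

  covered : (∀ B → ℕ→ℚ (DtA p k B) ≤ℚ kcLHS p x k B) → ℕ→ℚ D ≤ℚ kcLHS p x̄ k A
  covered cover = begin
    ℕ→ℚ D                                             ≡⟨ cong ℕ→ℚ (ℕ.m⊓n+n∸m≡n pSat D) ⟨
    ℕ→ℚ (pSat ℕ.⊓ D ℕ.+ (D ℕ.∸ pSat))                 ≡⟨ ℕ→ℚ-+ (pSat ℕ.⊓ D) (D ℕ.∸ pSat) ⟩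
    ℕ→ℚ (pSat ℕ.⊓ D) + ℕ→ℚ (D ℕ.∸ pSat)               ≤⟨ ℚ.+-mono-≤ (ℕ→ℚ-mono-≤ sumℕ-bonus) A⁺-covered ⟩
    ℕ→ℚ (sumℕ bonus) + kcLHS p x k A⁺                 ≡⟨ cong₂ _+_ (P.sym (sumℚ-ℕ→ℚ bonus))
                                                                    (kcLHS-coverTerm p x k A⁺) ⟩
    sumℚ (ℕ→ℚ ∘ bonus) + sumℚ (coverTerm p x k A⁺)    ≡⟨ sumℚ-+ (ℕ→ℚ ∘ bonus) (coverTerm p x k A⁺) ⟨
    sumℚ (λ j → ℕ→ℚ (bonus j) + coverTerm p x k A⁺ j) ≤⟨ sumℚ-mono-≤ termwise ⟩
    sumℚ (coverTerm p x̄ k A)                          ≡⟨ kcLHS-coverTerm p x̄ k A ⟨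
    kcLHS p x̄ k A                                     ∎
    where
    open ℚ.≤-Reasoning
    A⁺-covered : ℕ→ℚ (D ℕ.∸ pSat) ≤ℚ kcLHS p x k A⁺
    A⁺-covered = subst (λ d → ℕ→ℚ d ≤ℚ kcLHS p x k A⁺) DtA-A⁺ (cover A⁺)

module FirstPeriod {n} (p : Fin n → ℕ) (j : Fin n) (pⱼ≥1 : 1 ≤ p j) where

  others : Subset n
  others = tabulate (λ i → not (does (i Fin.≟ j)))

  T≡pⱼ+others : T p ≡ p j ℕ.+ pSum p others
  T≡pⱼ+others = P.trans (sumℕ-split (λ i → does (i Fin.≟ j)) p)
    (cong₂ ℕ._+_ (sumℕ-if-≡ p j)
      (sumℕ-cong λ i → cong (if_then p i else 0) (P.sym (∈?-tabulate (λ i → not (does (i Fin.≟ j))) i))))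

  T>0 : 0 ℕ.< T p
  T>0 = ℕ.≤-trans pⱼ≥1 (subst (p j ≤_) (P.sym T≡pⱼ+others) (ℕ.m≤m+n (p j) (pSum p others)))

  first : Fin (T p)
  first = Fin.fromℕ< T>0

  DtA-first-others : DtA p first others ≡ p j
  DtA-first-others = begin
    T p ℕ.∸ toℕ first ℕ.∸ pSum p others     ≡⟨ cong (λ t → T p ℕ.∸ t ℕ.∸ pSum p others) (Fin.toℕ-fromℕ< T>0) ⟩
    T p ℕ.∸ pSum p others                   ≡⟨ cong (ℕ._∸ pSum p others) T≡pⱼ+others ⟩
    p j ℕ.+ pSum p others ℕ.∸ pSum p others ≡⟨ ℕ.m+n∸n≡m (p j) (pSum p others) ⟩
    p j                                     ∎
    where open P.≡-Reasoning

  kcLHS-first-others : ∀ x → kcLHS p x first others ≡ ℕ→ℚ (p j) * sumℚ (x j)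
  kcLHS-first-others x = begin
    kcLHS p x first others                                ≡⟨ kcLHS-coverTerm p x first others ⟩
    sumℚ (coverTerm p x first others)                     ≡⟨ sumℚ-cong (λ i → not-others i) ⟩
    sumℚ (λ i → if does (i Fin.≟ j) then term i else 0ℚ)  ≡⟨ sumℚ-if-≡ term j ⟩
    ℕ→ℚ (p j ℕ.⊓ DtA p first others) * tailSum (toℕ first) (x j)
      ≡⟨ cong₂ (λ d t → ℕ→ℚ (p j ℕ.⊓ d) * tailSum t (x j)) DtA-first-others (Fin.toℕ-fromℕ< T>0) ⟩
    ℕ→ℚ (p j ℕ.⊓ p j) * sumℚ (x j)
      ≡⟨ cong (λ m → ℕ→ℚ m * sumℚ (x j)) (ℕ.⊓-idem (p j)) ⟩
    ℕ→ℚ (p j) * sumℚ (x j)                                ∎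
    where
    open P.≡-Reasoning
    term : Fin n → ℚ
    term i = ℕ→ℚ (pjtA p i first others) * tailSum (toℕ first) (x i)
    not-others : ∀ i → coverTerm p x first others i ≡ (if does (i Fin.≟ j) then term i else 0ℚ)
    not-others i = P.trans (cong (if_then 0ℚ else term i) (∈?-tabulate (λ i → not (does (i Fin.≟ j))) i))
                           (if-not (does (i Fin.≟ j)))

  sumℚ-≥1 : ∀ x → (∀ k A → ℕ→ℚ (DtA p k A) ≤ℚ kcLHS p x k A) → 1ℚ ≤ℚ sumℚ (x j)
  sumℚ-≥1 x cover = ℚ.*-cancelˡ-≤-pos (ℕ→ℚ (p j)) {{ℚ.normalize-pos (p j) 1 {{_}} {{ℕ.>-nonZero pⱼ≥1}}}}
    (subst₂ _≤ℚ_ (P.trans (cong ℕ→ℚ DtA-first-others) (P.sym (ℚ.*-identityʳ (ℕ→ℚ (p j)))))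
                 (kcLHS-first-others x) (cover first others))

lemma1 : (n : ℕ) (p : Fin n → ℕ) → (∀ j → 1 ≤ p j)
    → (f : Fin n → ℕ → ℕ) → (∀ j s t → 1 ≤ s → s ≤ t → f j s ≤ f j t)
    → (x : Fin n → Fin (T p) → ℚ) → Feasible p x
    → Σ (Fin n → Fin (T p) → ℚ) (λ xb →
        Feasible p xb
        × objective p f xb ≤ℚ objective p f x
        × (∀ j → sumℚ (xb j) ≡ 1ℚ))
lemma1 n p p≥1 f _ x (cover , x≥0) =
  x̄ , (covered , x̄≥0) , objective-mono-≤ p f x̄≤x , sum≡1
  where
  x̄ : Fin n → Fin (T p) → ℚ
  x̄ j = capTails (x j) 1ℚ
  covered : ∀ k A → ℕ→ℚ (DtA p k A) ≤ℚ kcLHS p x̄ k A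
  covered k A = KnapsackCover.covered p x x≥0 k A (cover k)
  x̄≥0 : ∀ j s → 0ℚ ≤ℚ x̄ j s
  x̄≥0 j = capTails-nonNeg (x j) 1ℚ (x≥0 j)
  x̄≤x : ∀ j s → x̄ j s ≤ℚ x j s
  x̄≤x j = capTails-≤ (x j) 1ℚ (x≥0 j)
  sum≡1 : ∀ j → sumℚ (x̄ j) ≡ 1ℚ
  sum≡1 j = P.trans (sumℚ-capTails (x j) (ℚ.nonNegative⁻¹ 1ℚ))
    (ℚ.p≥q⇒p⊓q≡q (FirstPeriod.sumℚ-≥1 p j (p≥1 j) x cover))
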